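{- For every program $P$, the poset $(\mathrm{Pos}(P),\leq)$ is a bounded lattice with $\bot$ as least element and $\top$ as greatest element, whose binary supremum $\vee$ satisfies (whenever the positions involved are positions of the relevant programs): $(p;q)\vee(p';q')=(p\vee p');(q\vee q')$; $(p\parallel q)\vee(p'\parallel q')=(p\vee p')\parallel(q\vee q')$; $p^{(n)}\vee p'^{(n)}=(p\vee p')^{(n)}$; $p^{(m)}\vee p'^{(n)}=p'^{(n)}$ for $m<n$; $(p+\bot)\vee(p'+\bot)=(p\vee p')+\bot$; $(\bot+q)\vee(\bot+q')=\bot+(q\vee q')$; and $(p+\bot)\vee(\bot+q)=\top$ when $p\neq\bot$ and $q\neq\bot$.
   Context: Fix a set $\mathcal A$ of actions. Programs are generated by $P,Q::=A\mid P;Q\mid P^{*}\mid P+Q\mid P\parallel Q$ with $A\in\mathcal A$. Pre-positions are generated by $p,q::=\bot\mid\top\mid p;q\mid p^{(n)}\mid p+q\mid p\parallel q$ with $n\in\mathbb N$. Validity $P\vdash p$ is defined inductively: $P\vdash\bot$ and $P\vdash\top$ for all $P$; if $P\vdash p$ then $P;Q\vdash p;\bot$, $P+Q\vdash p+\bot$, and $P^*\vdash p^{(n)}$ for all $n$; if $Q\vdash q$ then $P;Q\vdash\top;q$ and $P+Q\vdash\bot+q$; if $P\vdash p$ and $Q\vdash q$ then $P\parallel Q\vdash p\parallel q$. $\mathrm{Pos}(P)=\{p: P\vdash p\}$. The relation $\leq$ on positions of $P$ is the smallest reflexive relation such that: $\bot\leq p$; $p\leq\top$; if $p\leq p'$ and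 $q\leq q'$ then $p;q\leq p';q'$, $p+q\leq p'+q'$ and $p\parallel q\leq p'\parallel q'$; if $p\leq p'$ then $p^{(n)}\leq p'^{(n)}$; and $p^{(m)}\leq p'^{(n)}$ whenever $m<n$. -}

module Defs where

open import Data.Nat using (ℕ) renaming (_<_ to _<ℕ_)
open import Data.Product using (_×_)
open import Relation.Binary.PropositionalEquality using (_≡_)
open import Relation.Nullary using (¬_)

data Prog (Act : Set) : Set where
  act  : Act → Prog Act
  _⨾_  : Prog Act → Prog Act → Prog Act
  _*   : Prog Act → Prog Act
  _⊕_  : Prog Act → Prog Act → Prog Act
  _∥_  : Prog Act → Prog Act → Prog Act

data PrePos : Set where
  ⊥ₚ    : PrePos
  ⊤ₚ    : PrePos
  _⨾ₚ_  : PrePos → PrePos → PrePos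
  _^⟨_⟩ : PrePos → ℕ → PrePos
  _⊕ₚ_  : PrePos → PrePos → PrePos
  _∥ₚ_  : PrePos → PrePos → PrePos

data _⊢_ {Act : Set} : Prog Act → PrePos → Set where
  ⊢⊥    : ∀ {P} → P ⊢ ⊥ₚ
  ⊢⊤    : ∀ {P} → P ⊢ ⊤ₚ
  ⊢seqL : ∀ {P Q p} → P ⊢ p → (P ⨾ Q) ⊢ (p ⨾ₚ ⊥ₚ)
  ⊢seqR : ∀ {P Q q} → Q ⊢ q → (P ⨾ Q) ⊢ (⊤ₚ ⨾ₚ q)
  ⊢sumL : ∀ {P Q p} → P ⊢ p → (P ⊕ Q) ⊢ (p ⊕ₚ ⊥ₚ)
  ⊢sumR : ∀ {P Q q} → Q ⊢ q → (P ⊕ Q) ⊢ (⊥ₚ ⊕ₚ q)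
  ⊢star : ∀ {P p} (n : ℕ) → P ⊢ p → (P *) ⊢ (p ^⟨ n ⟩)
  ⊢par  : ∀ {P Q p q} → P ⊢ p → Q ⊢ q → (P ∥ Q) ⊢ (p ∥ₚ q)

data _≤ₚ_ : PrePos → PrePos → Set where
  ≤refl : ∀ {p} → p ≤ₚ p
  ≤bot  : ∀ {p} → ⊥ₚ ≤ₚ p
  ≤top  : ∀ {p} → p ≤ₚ ⊤ₚ
  ≤seq  : ∀ {p p' q q'} → p ≤ₚ p' → q ≤ₚ q' → (p ⨾ₚ q) ≤ₚ (p' ⨾ₚ q')
  ≤sum  : ∀ {p p' q q'} → p ≤ₚ p' → q ≤ₚ q' → (p ⊕ₚ q) ≤ₚ (p' ⊕ₚ q')
  ≤par  : ∀ {p p' q q'} → p ≤ₚ p' → q ≤ₚ q' → (p ∥ₚ q) ≤ₚ (p' ∥ₚ q')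
  ≤iter : ∀ {p p' n} → p ≤ₚ p' → (p ^⟨ n ⟩) ≤ₚ (p' ^⟨ n ⟩)
  ≤iterLt : ∀ {p p' m n} → m <ℕ n → (p ^⟨ m ⟩) ≤ₚ (p' ^⟨ n ⟩)

module _ {Act : Set} (P : Prog Act) where

  -- (Pos(P), ≤) is a partial order (reflexivity holds by ≤refl)
  IsPosetOn : Set
  IsPosetOn =
    (∀ {p q} → P ⊢ p → P ⊢ q → p ≤ₚ q → q ≤ₚ p → p ≡ q) ×
    (∀ {p q r} → P ⊢ p → P ⊢ q → P ⊢ r → p ≤ₚ q → q ≤ₚ r → p ≤ₚ r)

  IsBoundedBy⊥⊤ : Set
  IsBoundedBy⊥⊤ =
    P ⊢ ⊥ₚ × P ⊢ ⊤ₚ × (∀ {p} → P ⊢ p → ⊥ₚ ≤ₚ p) × (∀ {p} → P ⊢ p → p ≤ₚ ⊤ₚ)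

  IsSup : PrePos → PrePos → PrePos → Set
  IsSup p q j = P ⊢ j × p ≤ₚ j × q ≤ₚ j ×
    (∀ {u} → P ⊢ u → p ≤ₚ u → q ≤ₚ u → j ≤ₚ u)

  IsInf : PrePos → PrePos → PrePos → Set
  IsInf p q m = P ⊢ m × m ≤ₚ p × m ≤ₚ q ×
    (∀ {u} → P ⊢ u → u ≤ₚ p → u ≤ₚ q → u ≤ₚ m)

  IsBoundedLatticeOn : (PrePos → PrePos → PrePos) → (PrePos → PrePos → PrePos) → Set
  IsBoundedLatticeOn _∨_ _∧_ =
    IsPosetOn × IsBoundedBy⊥⊤ ×
    (∀ {p q} → P ⊢ p → P ⊢ q → IsSup p q (p ∨ q)) ×
    (∀ {p q} → P ⊢ p → P ⊢ q → IsInf p q (p ∧ q))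

JoinEquations : {Act : Set} → (Prog Act → PrePos → PrePos → PrePos) → Set
JoinEquations {Act} join =
  (∀ {P Q : Prog Act} {p p' q q'} → P ⊢ p → P ⊢ p' → Q ⊢ q → Q ⊢ q' →
     (P ⨾ Q) ⊢ (p ⨾ₚ q) → (P ⨾ Q) ⊢ (p' ⨾ₚ q') →
     join (P ⨾ Q) (p ⨾ₚ q) (p' ⨾ₚ q') ≡ (join P p p' ⨾ₚ join Q q q')) ×
  (∀ {P Q : Prog Act} {p p' q q'} → P ⊢ p → P ⊢ p' → Q ⊢ q → Q ⊢ q' →
     join (P ∥ Q) (p ∥ₚ q) (p' ∥ₚ q') ≡ (join P p p' ∥ₚ join Q q q')) ×
  (∀ {P : Prog Act} {p p'} (n : ℕ) → P ⊢ p → P ⊢ p' →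
     join (P *) (p ^⟨ n ⟩) (p' ^⟨ n ⟩) ≡ (join P p p' ^⟨ n ⟩)) ×
  (∀ {P : Prog Act} {p p'} {m n : ℕ} → m <ℕ n → P ⊢ p → P ⊢ p' →
     join (P *) (p ^⟨ m ⟩) (p' ^⟨ n ⟩) ≡ (p' ^⟨ n ⟩)) ×
  (∀ {P Q : Prog Act} {p p'} → P ⊢ p → P ⊢ p' →
     join (P ⊕ Q) (p ⊕ₚ ⊥ₚ) (p' ⊕ₚ ⊥ₚ) ≡ (join P p p' ⊕ₚ ⊥ₚ)) ×
  (∀ {P Q : Prog Act} {q q'} → Q ⊢ q → Q ⊢ q' →
     join (P ⊕ Q) (⊥ₚ ⊕ₚ q) (⊥ₚ ⊕ₚ q') ≡ (⊥ₚ ⊕ₚ join Q q q')) ×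
  (∀ {P Q : Prog Act} {p q} → P ⊢ p → Q ⊢ q → ¬ (p ≡ ⊥ₚ) → ¬ (q ≡ ⊥ₚ) →
     join (P ⊕ Q) (p ⊕ₚ ⊥ₚ) (⊥ₚ ⊕ₚ q) ≡ ⊤ₚ)

module Submission where

-- Suprema and infima are computed syntactically and componentwise, independently of the
-- program: positions of the same shape are combined in each component, iterations in
-- different rounds are compared by their round counts, and positions of different shapes
-- have join ⊤ and meet ⊥.  The one subtle case is the choice P + Q: its positions have at
-- most one branch different from ⊥, so (p + ⊥) ∨ (⊥ + q) with p, q ≠ ⊥ has no upper bound
-- but ⊤.  This is the only place where validity enters the universal property of the join.

open import Defs
open import Data.Nat using () renaming (_<_ to _<ℕ_)
open import Data.Nat.Properties using (<-cmp; <-irrefl; <-asym; <-trans)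
open import Data.Product using (Σ; _×_; _,_; map; zip′)
open import Relation.Binary.Definitions using (tri<; tri≈; tri>)
open import Relation.Binary.PropositionalEquality using (_≡_; refl; cong; cong₂; sym; subst)
open import Relation.Nullary using (¬_; Dec; yes; no; contradiction)

-- ≤ₚ without its reflexivity rule, which is admissible: every derivation is then
-- syntax-directed, so antisymmetry, transitivity and the lattice laws go by plain matching.
infix 4 _⊑_
data _⊑_ : PrePos → PrePos → Set where
  bot   : ∀ {p} → ⊥ₚ ⊑ p
  top   : ∀ {p} → p ⊑ ⊤ₚ
  seq   : ∀ {p p' q q'} → p ⊑ p' → q ⊑ q' → (p ⨾ₚ q) ⊑ (p' ⨾ₚ q')
  sum   : ∀ {p p' q q'} → p ⊑ p' → q ⊑ q' → (p ⊕ₚ q) ⊑ (p' ⊕ₚ q')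
  par   : ∀ {p p' q q'} → p ⊑ p' → q ⊑ q' → (p ∥ₚ q) ⊑ (p' ∥ₚ q')
  iter  : ∀ {p p' n} → p ⊑ p' → (p ^⟨ n ⟩) ⊑ (p' ^⟨ n ⟩)
  iter< : ∀ {p p' m n} → m <ℕ n → (p ^⟨ m ⟩) ⊑ (p' ^⟨ n ⟩)

⊑-refl : ∀ p → p ⊑ p
⊑-refl ⊥ₚ         = bot
⊑-refl ⊤ₚ         = top
⊑-refl (a ⨾ₚ b)   = seq (⊑-refl a) (⊑-refl b)
⊑-refl (a ^⟨ n ⟩) = iter (⊑-refl a)
⊑-refl (a ⊕ₚ b)   = sum (⊑-refl a) (⊑-refl b)
⊑-refl (a ∥ₚ b)   = par (⊑-refl a) (⊑-refl b)

≤ₚ⇒⊑ : ∀ {p q} → p ≤ₚ q → p ⊑ q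
≤ₚ⇒⊑ ≤refl         = ⊑-refl _
≤ₚ⇒⊑ ≤bot          = bot
≤ₚ⇒⊑ ≤top          = top
≤ₚ⇒⊑ (≤seq a b)    = seq (≤ₚ⇒⊑ a) (≤ₚ⇒⊑ b)
≤ₚ⇒⊑ (≤sum a b)    = sum (≤ₚ⇒⊑ a) (≤ₚ⇒⊑ b)
≤ₚ⇒⊑ (≤par a b)    = par (≤ₚ⇒⊑ a) (≤ₚ⇒⊑ b)
≤ₚ⇒⊑ (≤iter a)     = iter (≤ₚ⇒⊑ a)
≤ₚ⇒⊑ (≤iterLt m<n) = iter< m<n

⊑⇒≤ₚ : ∀ {p q} → p ⊑ q → p ≤ₚ q
⊑⇒≤ₚ bot         = ≤bot
⊑⇒≤ₚ top         = ≤top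
⊑⇒≤ₚ (seq a b)   = ≤seq (⊑⇒≤ₚ a) (⊑⇒≤ₚ b)
⊑⇒≤ₚ (sum a b)   = ≤sum (⊑⇒≤ₚ a) (⊑⇒≤ₚ b)
⊑⇒≤ₚ (par a b)   = ≤par (⊑⇒≤ₚ a) (⊑⇒≤ₚ b)
⊑⇒≤ₚ (iter a)    = ≤iter (⊑⇒≤ₚ a)
⊑⇒≤ₚ (iter< m<n) = ≤iterLt m<n

⊑-antisym : ∀ {p q} → p ⊑ q → q ⊑ p → p ≡ q
⊑-antisym bot         bot         = refl
⊑-antisym top         top         = refl
⊑-antisym (seq a b)   (seq c d)   = cong₂ _⨾ₚ_ (⊑-antisym a c) (⊑-antisym b d)
⊑-antisym (sum a b)   (sum c d)   = cong₂ _⊕ₚ_ (⊑-antisym a c) (⊑-antisym b d)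
⊑-antisym (par a b)   (par c d)   = cong₂ _∥ₚ_ (⊑-antisym a c) (⊑-antisym b d)
⊑-antisym (iter a)    (iter c)    = cong (_^⟨ _ ⟩) (⊑-antisym a c)
⊑-antisym (iter a)    (iter< n<n) = contradiction n<n (<-irrefl refl)
⊑-antisym (iter< n<n) (iter _)    = contradiction n<n (<-irrefl refl)
⊑-antisym (iter< m<n) (iter< n<m) = contradiction n<m (<-asym m<n)

⊑-trans : ∀ {p q r} → p ⊑ q → q ⊑ r → p ⊑ r
⊑-trans bot         _           = bot
⊑-trans _           top         = top
⊑-trans (seq a b)   (seq c d)   = seq (⊑-trans a c) (⊑-trans b d)
⊑-trans (sum a b)   (sum c d)   = sum (⊑-trans a c) (⊑-trans b d)
⊑-trans (par a b)   (par c d)   = par (⊑-trans a c) (⊑-trans b d)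
⊑-trans (iter a)    (iter c)    = iter (⊑-trans a c)
⊑-trans (iter _)    (iter< m<n) = iter< m<n
⊑-trans (iter< m<n) (iter _)    = iter< m<n
⊑-trans (iter< l<m) (iter< m<n) = iter< (<-trans l<m m<n)

_≟⊥ : (p : PrePos) → Dec (p ≡ ⊥ₚ)
⊥ₚ         ≟⊥ = yes refl
⊤ₚ         ≟⊥ = no λ ()
(_ ⨾ₚ _)   ≟⊥ = no λ ()
(_ ^⟨ _ ⟩) ≟⊥ = no λ ()
(_ ⊕ₚ _)   ≟⊥ = no λ ()
(_ ∥ₚ _)   ≟⊥ = no λ ()

_⊕⊔_ : PrePos → PrePos → PrePos
p ⊕⊔ q with p ≟⊥ | q ≟⊥
... | no _ | no _ = ⊤ₚ
... | _    | _    = p ⊕ₚ q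

p⊕⊔⊥≡p⊕⊥ : ∀ p → p ⊕⊔ ⊥ₚ ≡ (p ⊕ₚ ⊥ₚ)
p⊕⊔⊥≡p⊕⊥ p with p ≟⊥
... | yes _ = refl
... | no _  = refl

p⊕⊔q≡⊤ : ∀ {p q} → ¬ p ≡ ⊥ₚ → ¬ q ≡ ⊥ₚ → p ⊕⊔ q ≡ ⊤ₚ
p⊕⊔q≡⊤ {p} {q} p≢⊥ q≢⊥ with p ≟⊥ | q ≟⊥
... | yes p≡⊥ | _       = contradiction p≡⊥ p≢⊥
... | no _    | yes q≡⊥ = contradiction q≡⊥ q≢⊥
... | no _    | no _    = refl

⊕-⊑-⊕⊔ : ∀ {p p' q q'} → p ⊑ p' → q ⊑ q' → (p ⊕ₚ q) ⊑ (p' ⊕⊔ q')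
⊕-⊑-⊕⊔ {p' = p'} {q' = q'} a b with p' ≟⊥ | q' ≟⊥
... | no _  | no _  = top
... | yes _ | _     = sum a b
... | no _  | yes _ = sum a b

⊕⊔-pres-⊢ : ∀ {Act} {P Q : Prog Act} {p q} → P ⊢ p → Q ⊢ q → (P ⊕ Q) ⊢ (p ⊕⊔ q)
⊕⊔-pres-⊢ {p = p} {q} ⊢p ⊢q with p ≟⊥ | q ≟⊥
... | no _     | no _     = ⊢⊤
... | yes refl | _        = ⊢sumR ⊢q
... | no _     | yes refl = ⊢sumL ⊢p

infixl 6 _⊔_
_⊔_ : PrePos → PrePos → PrePos
⊥ₚ ⊔ q = q
⊤ₚ ⊔ q = ⊤ₚ
p ⊔ ⊥ₚ = p
p ⊔ ⊤ₚ = ⊤ₚ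
(a ⨾ₚ b) ⊔ (c ⨾ₚ d) = (a ⊔ c) ⨾ₚ (b ⊔ d)
(a ^⟨ m ⟩) ⊔ (c ^⟨ n ⟩) with <-cmp m n
... | tri< _ _ _ = c ^⟨ n ⟩
... | tri≈ _ _ _ = (a ⊔ c) ^⟨ n ⟩
... | tri> _ _ _ = a ^⟨ m ⟩
(a ⊕ₚ b) ⊔ (c ⊕ₚ d) = (a ⊔ c) ⊕⊔ (b ⊔ d)
(a ∥ₚ b) ⊔ (c ∥ₚ d) = (a ⊔ c) ∥ₚ (b ⊔ d)
_ ⊔ _ = ⊤ₚ

infixl 7 _⊓_
_⊓_ : PrePos → PrePos → PrePos
⊥ₚ ⊓ q = ⊥ₚ
⊤ₚ ⊓ q = q
p ⊓ ⊥ₚ = ⊥ₚ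
p ⊓ ⊤ₚ = p
(a ⨾ₚ b) ⊓ (c ⨾ₚ d) = (a ⊓ c) ⨾ₚ (b ⊓ d)
(a ^⟨ m ⟩) ⊓ (c ^⟨ n ⟩) with <-cmp m n
... | tri< _ _ _ = a ^⟨ m ⟩
... | tri≈ _ _ _ = (a ⊓ c) ^⟨ n ⟩
... | tri> _ _ _ = c ^⟨ n ⟩
(a ⊕ₚ b) ⊓ (c ⊕ₚ d) = (a ⊓ c) ⊕ₚ (b ⊓ d)
(a ∥ₚ b) ⊓ (c ∥ₚ d) = (a ⊓ c) ∥ₚ (b ⊓ d)
_ ⊓ _ = ⊥ₚ

⊔-identityʳ : ∀ p → p ⊔ ⊥ₚ ≡ p
⊔-identityʳ ⊥ₚ         = refl
⊔-identityʳ ⊤ₚ         = refl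
⊔-identityʳ (_ ⨾ₚ _)   = refl
⊔-identityʳ (_ ^⟨ _ ⟩) = refl
⊔-identityʳ (_ ⊕ₚ _)   = refl
⊔-identityʳ (_ ∥ₚ _)   = refl

⊔-zeroʳ : ∀ p → p ⊔ ⊤ₚ ≡ ⊤ₚ
⊔-zeroʳ ⊥ₚ         = refl
⊔-zeroʳ ⊤ₚ         = refl
⊔-zeroʳ (_ ⨾ₚ _)   = refl
⊔-zeroʳ (_ ^⟨ _ ⟩) = refl
⊔-zeroʳ (_ ⊕ₚ _)   = refl
⊔-zeroʳ (_ ∥ₚ _)   = refl

⊓-zeroʳ : ∀ p → p ⊓ ⊥ₚ ≡ ⊥ₚ
⊓-zeroʳ ⊥ₚ         = refl
⊓-zeroʳ ⊤ₚ         = refl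
⊓-zeroʳ (_ ⨾ₚ _)   = refl
⊓-zeroʳ (_ ^⟨ _ ⟩) = refl
⊓-zeroʳ (_ ⊕ₚ _)   = refl
⊓-zeroʳ (_ ∥ₚ _)   = refl

⊓-identityʳ : ∀ p → p ⊓ ⊤ₚ ≡ p
⊓-identityʳ ⊥ₚ         = refl
⊓-identityʳ ⊤ₚ         = refl
⊓-identityʳ (_ ⨾ₚ _)   = refl
⊓-identityʳ (_ ^⟨ _ ⟩) = refl
⊓-identityʳ (_ ⊕ₚ _)   = refl
⊓-identityʳ (_ ∥ₚ _)   = refl

^-⊔-^ : ∀ p p' n → (p ^⟨ n ⟩) ⊔ (p' ^⟨ n ⟩) ≡ ((p ⊔ p') ^⟨ n ⟩)
^-⊔-^ p p' n with <-cmp n n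
... | tri< n<n _ _ = contradiction n<n (<-irrefl refl)
... | tri≈ _ _ _   = refl
... | tri> _ _ n<n = contradiction n<n (<-irrefl refl)

^-⊔-^< : ∀ p p' {m n} → m <ℕ n → (p ^⟨ m ⟩) ⊔ (p' ^⟨ n ⟩) ≡ (p' ^⟨ n ⟩)
^-⊔-^< p p' {m} {n} m<n with <-cmp m n
... | tri< _ _ _   = refl
... | tri≈ _ m≡n _ = contradiction m<n (<-irrefl m≡n)
... | tri> _ _ n<m = contradiction n<m (<-asym m<n)

⊔-upperBounds : ∀ p q → p ⊑ p ⊔ q × q ⊑ p ⊔ q
⊔-upperBounds ⊥ₚ         q          = bot , ⊑-refl q
⊔-upperBounds ⊤ₚ         q          = top , top
⊔-upperBounds (a ⨾ₚ b)   ⊥ₚ         = ⊑-refl _ , bot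
⊔-upperBounds (a ⨾ₚ b)   ⊤ₚ         = top , top
⊔-upperBounds (a ⨾ₚ b)   (c ⨾ₚ d)   = zip′ seq seq (⊔-upperBounds a c) (⊔-upperBounds b d)
⊔-upperBounds (a ⨾ₚ b)   (c ^⟨ n ⟩) = top , top
⊔-upperBounds (a ⨾ₚ b)   (c ⊕ₚ d)   = top , top
⊔-upperBounds (a ⨾ₚ b)   (c ∥ₚ d)   = top , top
⊔-upperBounds (a ^⟨ m ⟩) ⊥ₚ         = ⊑-refl _ , bot
⊔-upperBounds (a ^⟨ m ⟩) ⊤ₚ         = top , top
⊔-upperBounds (a ^⟨ m ⟩) (c ⨾ₚ d)   = top , top
⊔-upperBounds (a ^⟨ m ⟩) (c ^⟨ n ⟩) with <-cmp m n
... | tri< m<n _    _   = iter< m<n , ⊑-refl _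
... | tri≈ _    refl _  = map iter iter (⊔-upperBounds a c)
... | tri> _    _   n<m = ⊑-refl _ , iter< n<m
⊔-upperBounds (a ^⟨ m ⟩) (c ⊕ₚ d)   = top , top
⊔-upperBounds (a ^⟨ m ⟩) (c ∥ₚ d)   = top , top
⊔-upperBounds (a ⊕ₚ b)   ⊥ₚ         = ⊑-refl _ , bot
⊔-upperBounds (a ⊕ₚ b)   ⊤ₚ         = top , top
⊔-upperBounds (a ⊕ₚ b)   (c ⨾ₚ d)   = top , top
⊔-upperBounds (a ⊕ₚ b)   (c ^⟨ n ⟩) = top , top
⊔-upperBounds (a ⊕ₚ b)   (c ⊕ₚ d)   = zip′ ⊕-⊑-⊕⊔ ⊕-⊑-⊕⊔ (⊔-upperBounds a c) (⊔-upperBounds b d)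
⊔-upperBounds (a ⊕ₚ b)   (c ∥ₚ d)   = top , top
⊔-upperBounds (a ∥ₚ b)   ⊥ₚ         = ⊑-refl _ , bot
⊔-upperBounds (a ∥ₚ b)   ⊤ₚ         = top , top
⊔-upperBounds (a ∥ₚ b)   (c ⨾ₚ d)   = top , top
⊔-upperBounds (a ∥ₚ b)   (c ^⟨ n ⟩) = top , top
⊔-upperBounds (a ∥ₚ b)   (c ⊕ₚ d)   = top , top
⊔-upperBounds (a ∥ₚ b)   (c ∥ₚ d)   = zip′ par par (⊔-upperBounds a c) (⊔-upperBounds b d)

⊓-lowerBounds : ∀ p q → p ⊓ q ⊑ p × p ⊓ q ⊑ q
⊓-lowerBounds ⊥ₚ         q          = bot , bot
⊓-lowerBounds ⊤ₚ         q          = top , ⊑-refl q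
⊓-lowerBounds (a ⨾ₚ b)   ⊥ₚ         = bot , bot
⊓-lowerBounds (a ⨾ₚ b)   ⊤ₚ         = ⊑-refl _ , top
⊓-lowerBounds (a ⨾ₚ b)   (c ⨾ₚ d)   = zip′ seq seq (⊓-lowerBounds a c) (⊓-lowerBounds b d)
⊓-lowerBounds (a ⨾ₚ b)   (c ^⟨ n ⟩) = bot , bot
⊓-lowerBounds (a ⨾ₚ b)   (c ⊕ₚ d)   = bot , bot
⊓-lowerBounds (a ⨾ₚ b)   (c ∥ₚ d)   = bot , bot
⊓-lowerBounds (a ^⟨ m ⟩) ⊥ₚ         = bot , bot
⊓-lowerBounds (a ^⟨ m ⟩) ⊤ₚ         = ⊑-refl _ , top
⊓-lowerBounds (a ^⟨ m ⟩) (c ⨾ₚ d)   = bot , bot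
⊓-lowerBounds (a ^⟨ m ⟩) (c ^⟨ n ⟩) with <-cmp m n
... | tri< m<n _    _   = ⊑-refl _ , iter< m<n
... | tri≈ _    refl _  = map iter iter (⊓-lowerBounds a c)
... | tri> _    _   n<m = iter< n<m , ⊑-refl _
⊓-lowerBounds (a ^⟨ m ⟩) (c ⊕ₚ d)   = bot , bot
⊓-lowerBounds (a ^⟨ m ⟩) (c ∥ₚ d)   = bot , bot
⊓-lowerBounds (a ⊕ₚ b)   ⊥ₚ         = bot , bot
⊓-lowerBounds (a ⊕ₚ b)   ⊤ₚ         = ⊑-refl _ , top
⊓-lowerBounds (a ⊕ₚ b)   (c ⨾ₚ d)   = bot , bot
⊓-lowerBounds (a ⊕ₚ b)   (c ^⟨ n ⟩) = bot , bot
⊓-lowerBounds (a ⊕ₚ b)   (c ⊕ₚ d)   = zip′ sum sum (⊓-lowerBounds a c) (⊓-lowerBounds b d)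
⊓-lowerBounds (a ⊕ₚ b)   (c ∥ₚ d)   = bot , bot
⊓-lowerBounds (a ∥ₚ b)   ⊥ₚ         = bot , bot
⊓-lowerBounds (a ∥ₚ b)   ⊤ₚ         = ⊑-refl _ , top
⊓-lowerBounds (a ∥ₚ b)   (c ⨾ₚ d)   = bot , bot
⊓-lowerBounds (a ∥ₚ b)   (c ^⟨ n ⟩) = bot , bot
⊓-lowerBounds (a ∥ₚ b)   (c ⊕ₚ d)   = bot , bot
⊓-lowerBounds (a ∥ₚ b)   (c ∥ₚ d)   = zip′ par par (⊓-lowerBounds a c) (⊓-lowerBounds b d)

⊓-glb : ∀ {p q u} → u ⊑ p → u ⊑ q → u ⊑ p ⊓ q
⊓-glb bot         _         = bot
⊓-glb top         u⊑q       = u⊑q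
⊓-glb (seq a b)   top       = seq a b
⊓-glb (seq a b)   (seq c d) = seq (⊓-glb a c) (⊓-glb b d)
⊓-glb (sum a b)   top       = sum a b
⊓-glb (sum a b)   (sum c d) = sum (⊓-glb a c) (⊓-glb b d)
⊓-glb (par a b)   top       = par a b
⊓-glb (par a b)   (par c d) = par (⊓-glb a c) (⊓-glb b d)
⊓-glb (iter a)    top       = iter a
⊓-glb (iter< m<n) top       = iter< m<n
⊓-glb {a ^⟨ m ⟩} {c ^⟨ n ⟩} u⊑p u⊑q with <-cmp m n
... | tri< _ _ _ = u⊑p
... | tri> _ _ _ = u⊑q
⊓-glb bot         _           | tri≈ _ refl _ = bot
⊓-glb (iter a)    (iter c)    | tri≈ _ refl _ = iter (⊓-glb a c)
⊓-glb (iter< l<n) _           | tri≈ _ refl _ = iter< l<n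
⊓-glb (iter _)    (iter< l<n) | tri≈ _ refl _ = iter< l<n

module _ {Act : Set} where

  ⊔-lub : ∀ {P : Prog Act} {p q u} → P ⊢ u → p ⊑ u → q ⊑ u → p ⊔ q ⊑ u
  ⊔-lub _ bot q⊑u = q⊑u
  ⊔-lub _ top _   = top
  ⊔-lub _ (seq a b) bot = seq a b
  ⊔-lub (⊢seqL {Q = Q} ⊢x) (seq a b) (seq c d) = seq (⊔-lub ⊢x a c) (⊔-lub {P = Q} ⊢⊥ b d)
  ⊔-lub (⊢seqR {P = P} ⊢y) (seq a b) (seq c d) = seq (⊔-lub {P = P} ⊢⊤ a c) (⊔-lub ⊢y b d)
  ⊔-lub _ (sum a b) bot = sum a b
  ⊔-lub (⊢sumL ⊢x) (sum {p = a} a⊑x bot) (sum {p = c} c⊑x bot)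
    rewrite p⊕⊔⊥≡p⊕⊥ (a ⊔ c) = sum (⊔-lub ⊢x a⊑x c⊑x) bot
  ⊔-lub (⊢sumR ⊢y) (sum bot b⊑y) (sum bot d⊑y) = sum bot (⊔-lub ⊢y b⊑y d⊑y)
  ⊔-lub _ (par a b) bot = par a b
  ⊔-lub (⊢par ⊢x ⊢y) (par a b) (par c d) = par (⊔-lub ⊢x a c) (⊔-lub ⊢y b d)
  ⊔-lub _ (iter a)    bot = iter a
  ⊔-lub _ (iter< m<n) bot = iter< m<n
  ⊔-lub {p = a ^⟨ m ⟩} {c ^⟨ n ⟩} (⊢star _ ⊢x) p⊑u q⊑u with <-cmp m n
  ... | tri< _ _ _ = q⊑u
  ... | tri> _ _ _ = p⊑u
  ⊔-lub (⊢star _ ⊢x) (iter a)    (iter c)    | tri≈ _ refl _ = iter (⊔-lub ⊢x a c)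
  ⊔-lub (⊢star _ ⊢x) (iter< m<k) _           | tri≈ _ refl _ = iter< m<k
  ⊔-lub (⊢star _ ⊢x) (iter _)    (iter< m<k) | tri≈ _ refl _ = iter< m<k

  ⊔-pres-⊢ : ∀ {P : Prog Act} {p q} → P ⊢ p → P ⊢ q → P ⊢ (p ⊔ q)
  ⊔-pres-⊢ ⊢⊥ ⊢q = ⊢q
  ⊔-pres-⊢ ⊢⊤ _  = ⊢⊤
  ⊔-pres-⊢ {P} {p} ⊢p ⊢⊥ = subst (P ⊢_) (sym (⊔-identityʳ p)) ⊢p
  ⊔-pres-⊢ {P} {p} _  ⊢⊤ = subst (P ⊢_) (sym (⊔-zeroʳ p)) ⊢⊤
  ⊔-pres-⊢ (⊢seqL ⊢a) (⊢seqL ⊢c) = ⊢seqL (⊔-pres-⊢ ⊢a ⊢c)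
  ⊔-pres-⊢ (⊢seqL {p = a} _) (⊢seqR ⊢d) rewrite ⊔-zeroʳ a = ⊢seqR ⊢d
  ⊔-pres-⊢ (⊢seqR {q = b} ⊢b) (⊢seqL _) rewrite ⊔-identityʳ b = ⊢seqR ⊢b
  ⊔-pres-⊢ (⊢seqR ⊢b) (⊢seqR ⊢d) = ⊢seqR (⊔-pres-⊢ ⊢b ⊢d)
  ⊔-pres-⊢ (⊢sumL ⊢a) (⊢sumL ⊢c) = ⊕⊔-pres-⊢ (⊔-pres-⊢ ⊢a ⊢c) ⊢⊥
  ⊔-pres-⊢ (⊢sumL {p = a} ⊢a) (⊢sumR ⊢d) rewrite ⊔-identityʳ a = ⊕⊔-pres-⊢ ⊢a ⊢d
  ⊔-pres-⊢ (⊢sumR {q = b} ⊢b) (⊢sumL ⊢c) rewrite ⊔-identityʳ b = ⊕⊔-pres-⊢ ⊢c ⊢b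
  ⊔-pres-⊢ (⊢sumR ⊢b) (⊢sumR ⊢d) = ⊕⊔-pres-⊢ ⊢⊥ (⊔-pres-⊢ ⊢b ⊢d)
  ⊔-pres-⊢ (⊢star m ⊢a) (⊢star n ⊢c) with <-cmp m n
  ... | tri< _ _ _ = ⊢star n ⊢c
  ... | tri≈ _ _ _ = ⊢star n (⊔-pres-⊢ ⊢a ⊢c)
  ... | tri> _ _ _ = ⊢star m ⊢a
  ⊔-pres-⊢ (⊢par ⊢a ⊢b) (⊢par ⊢c ⊢d) = ⊢par (⊔-pres-⊢ ⊢a ⊢c) (⊔-pres-⊢ ⊢b ⊢d)

  ⊓-pres-⊢ : ∀ {P : Prog Act} {p q} → P ⊢ p → P ⊢ q → P ⊢ (p ⊓ q)
  ⊓-pres-⊢ ⊢⊥ _  = ⊢⊥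
  ⊓-pres-⊢ ⊢⊤ ⊢q = ⊢q
  ⊓-pres-⊢ {P} {p} _  ⊢⊥ = subst (P ⊢_) (sym (⊓-zeroʳ p)) ⊢⊥
  ⊓-pres-⊢ {P} {p} ⊢p ⊢⊤ = subst (P ⊢_) (sym (⊓-identityʳ p)) ⊢p
  ⊓-pres-⊢ (⊢seqL ⊢a) (⊢seqL ⊢c) = ⊢seqL (⊓-pres-⊢ ⊢a ⊢c)
  ⊓-pres-⊢ (⊢seqL {p = a} ⊢a) (⊢seqR _) rewrite ⊓-identityʳ a = ⊢seqL ⊢a
  ⊓-pres-⊢ (⊢seqR {q = b} _) (⊢seqL ⊢c) rewrite ⊓-zeroʳ b = ⊢seqL ⊢c
  ⊓-pres-⊢ (⊢seqR ⊢b) (⊢seqR ⊢d) = ⊢seqR (⊓-pres-⊢ ⊢b ⊢d)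
  ⊓-pres-⊢ (⊢sumL ⊢a) (⊢sumL ⊢c) = ⊢sumL (⊓-pres-⊢ ⊢a ⊢c)
  ⊓-pres-⊢ (⊢sumL {p = a} _) (⊢sumR _) rewrite ⊓-zeroʳ a = ⊢sumL ⊢⊥
  ⊓-pres-⊢ (⊢sumR {q = b} _) (⊢sumL _) rewrite ⊓-zeroʳ b = ⊢sumR ⊢⊥
  ⊓-pres-⊢ (⊢sumR ⊢b) (⊢sumR ⊢d) = ⊢sumR (⊓-pres-⊢ ⊢b ⊢d)
  ⊓-pres-⊢ (⊢star m ⊢a) (⊢star n ⊢c) with <-cmp m n
  ... | tri< _ _ _ = ⊢star m ⊢a
  ... | tri≈ _ _ _ = ⊢star n (⊓-pres-⊢ ⊢a ⊢c)
  ... | tri> _ _ _ = ⊢star n ⊢c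
  ⊓-pres-⊢ (⊢par ⊢a ⊢b) (⊢par ⊢c ⊢d) = ⊢par (⊓-pres-⊢ ⊢a ⊢c) (⊓-pres-⊢ ⊢b ⊢d)

  Pos-isBoundedLattice : (P : Prog Act) → IsBoundedLatticeOn P _⊔_ _⊓_
  Pos-isBoundedLattice P =
      ( (λ _ _ p≤q q≤p → ⊑-antisym (≤ₚ⇒⊑ p≤q) (≤ₚ⇒⊑ q≤p))
      , (λ _ _ _ p≤q q≤r → ⊑⇒≤ₚ (⊑-trans (≤ₚ⇒⊑ p≤q) (≤ₚ⇒⊑ q≤r))) )
    , (⊢⊥ , ⊢⊤ , (λ _ → ≤bot) , (λ _ → ≤top))
    , (λ {p} {q} ⊢p ⊢q → let p⊑ , q⊑ = ⊔-upperBounds p q in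
         ⊔-pres-⊢ ⊢p ⊢q , ⊑⇒≤ₚ p⊑ , ⊑⇒≤ₚ q⊑ ,
         λ ⊢u p≤u q≤u → ⊑⇒≤ₚ (⊔-lub ⊢u (≤ₚ⇒⊑ p≤u) (≤ₚ⇒⊑ q≤u)))
    , (λ {p} {q} ⊢p ⊢q → let ⊑p , ⊑q = ⊓-lowerBounds p q in
         ⊓-pres-⊢ ⊢p ⊢q , ⊑⇒≤ₚ ⊑p , ⊑⇒≤ₚ ⊑q ,
         λ _ u≤p u≤q → ⊑⇒≤ₚ (⊓-glb (≤ₚ⇒⊑ u≤p) (≤ₚ⇒⊑ u≤q)))

  ⊔-joinEquations : JoinEquations {Act} (λ _ → _⊔_)
  ⊔-joinEquations =
      (λ _ _ _ _ _ _ → refl)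
    , (λ _ _ _ _ → refl)
    , (λ {_} {p} {p'} n _ _ → ^-⊔-^ p p' n)
    , (λ {_} {p} {p'} m<n _ _ → ^-⊔-^< p p' m<n)
    , (λ {_} {_} {p} {p'} _ _ → p⊕⊔⊥≡p⊕⊥ (p ⊔ p'))
    , (λ _ _ → refl)
    , (λ {_} {_} {p} _ _ p≢⊥ q≢⊥ → subst (λ r → r ⊕⊔ _ ≡ ⊤ₚ) (sym (⊔-identityʳ p)) (p⊕⊔q≡⊤ p≢⊥ q≢⊥))

proposition2p10 : {Act : Set} →
    Σ (Prog Act → PrePos → PrePos → PrePos) λ join →
    Σ (Prog Act → PrePos → PrePos → PrePos) λ meet →
    ((P : Prog Act) → IsBoundedLatticeOn P (join P) (meet P)) × JoinEquations join
proposition2p10 = (λ _ → _⊔_) , (λ _ → _⊓_) , Pos-isBoundedLattice , ⊔-joinEquations
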